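{- Let $p\geq 3$ be a prime number and let $1\leq r_1\leq\cdots\leq r_\beta\leq p-1$ be integers such that $p$ divides $\sum_{j=1}^{\beta}r_j$. For an integer $k$ put $H(k)=\sum_{j=1}^{\beta}\left\{\frac{kr_j}{p}\right\}$, where $\{x\}=x-[x]$ denotes the fractional part. Let $1\leq\theta\leq p-1$ be an integer such that $H(k)=1$ for all $1\leq k\leq\theta$. Then $\beta\leq p$ and $\theta\leq\left[\frac{p}{\beta-1}\right]$.
   Context: $[x]$ denotes the integral part of a rational number $x$ and $\{x\}=x-[x]$ its fractional part. -}

module Defs where

open import Data.Nat using (ℕ; _*_; NonZero)
open import Data.Fin using (Fin)
open import Data.List using (List; map; foldr; allFin)
open import Data.Integer using (+_)
open import Data.Rational using (ℚ; _+_; _-_; 0ℚ; _/_; floor)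

sumℕ : ∀ {β} → (Fin β → ℕ) → ℕ
sumℕ {β} f = foldr Data.Nat._+_ 0 (map f (allFin β))

sumℚ : ∀ {β} → (Fin β → ℚ) → ℚ
sumℚ {β} f = foldr _+_ 0ℚ (map f (allFin β))

frac : ℚ → ℚ
frac x = x - (floor x / 1)

H : (p : ℕ) → .{{NonZero p}} → ∀ {β} → (Fin β → ℕ) → ℕ → ℚ
H p r k = sumℚ (λ j → frac ((+ (k * r j)) / p))

module Submission where

-- Idea of the proof.  Write c_j(k) = (k r_j) mod p.  Since {k r_j / p} = c_j(k) / p,
-- the hypothesis H(k) = 1 says  Σ_j c_j(k) = p  for 1 ≤ k ≤ θ.
--
-- * k = 1 gives Σ_j r_j = p; as every r_j lies in [1, p-1], this forces
--   2 ≤ β ≤ p.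
-- * Fix 1 ≤ a < θ and b = θ - a.  Then c_j(a) + c_j(b) = c_j(θ) + w_j p with
--   w_j ∈ ℕ, and summing over j gives Σ_j w_j = 1: the addition "wraps around"
--   for exactly one index, so c_j(a) < c_j(θ) for at least β - 1 indices j.
--   For a = 0 this holds for all β indices since c_j(θ) > 0.
-- * Conversely, for fixed j the map a ↦ c_j(a) is injective on [0, θ) because
--   p is prime, so at most c_j(θ) values a < θ satisfy c_j(a) < c_j(θ).
-- Double counting the pairs (a, j) with c_j(a) < c_j(θ) yields
-- θ (β - 1) ≤ Σ_j c_j(θ) = p, i.e. θ ≤ [p / (β - 1)].

open import Defs
open import Data.Nat using (ℕ; suc; _≤_; _∸_; _/_; NonZero)
open import Data.Nat.Divisibility using (_∣_)
open import Data.Nat.Primality using (Prime)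
open import Data.Fin using (Fin)
open import Data.Product using (_×_; ∃-syntax)
open import Relation.Binary.PropositionalEquality using (_≡_)
open import Data.Rational using (1ℚ)

open import Data.Nat using (zero; _+_; _*_; _%_; _<_; z≤n; s≤s; _≟_; _<?_; >-nonZero; ≢-nonZero; ≢-nonZero⁻¹)
open import Data.Nat.Properties
open import Data.Nat.DivMod
  using (m≡m%n+[m/n]*n; %-distribˡ-+; m<n⇒m%n≡m; m*n/n≡m; /-monoˡ-≤; m/n*n≡m; m*n/o*n≡m/o; /-congˡ; /-congʳ)
open import Data.Nat.Divisibility using (divides; ∣⇒≤; m%n≡0⇒n∣m)
open import Data.Nat.Primality using (euclidsLemma)
open import Data.Fin as Fin using (toℕ)
open import Data.Fin.Properties using (toℕ-injective; toℕ<n) renaming (suc-injective to Fin-suc-injective)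
open import Data.List using (List; []; _∷_; map; foldr; allFin; tabulate)
open import Data.List.Properties using (map-tabulate)
open import Data.Product using (_,_; proj₁; proj₂)
open import Data.Sum using (inj₁; inj₂)
open import Data.Empty using (⊥; ⊥-elim)
open import Function.Definitions using (Injective)
open import Relation.Binary.Definitions using (tri<; tri≈; tri>)
open import Relation.Binary.PropositionalEquality
  using (_≢_; refl; sym; trans; cong; cong₂; subst; module ≡-Reasoning)
open import Relation.Nullary using (Dec; yes; no)
open import Algebra.Properties.Semiring.Sum +-*-semiring
  using (sum; sum-syntax; ∑-comm; ∑-distrib-+; *-distribʳ-sum; sum-cong-≗; sum-replicate-zero)

sumℕ≡sum : ∀ {β} (f : Fin β → ℕ) → sumℕ f ≡ sum f
sumℕ≡sum {zero}  f = refl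
sumℕ≡sum {suc β} f = cong (f Fin.zero +_) (begin
    foldr _+_ 0 (map f (tabulate Fin.suc))
  ≡⟨ cong (foldr _+_ 0) (map-tabulate Fin.suc f) ⟩
    foldr _+_ 0 (tabulate (λ i → f (Fin.suc i)))
  ≡⟨ cong (foldr _+_ 0) (sym (map-tabulate (λ i → i) (λ i → f (Fin.suc i)))) ⟩
    sumℕ (λ i → f (Fin.suc i))
  ≡⟨ sumℕ≡sum (λ i → f (Fin.suc i)) ⟩
    sum (λ i → f (Fin.suc i)) ∎)
  where open ≡-Reasoning

∑-mono-≤ : ∀ {n} {f g : Fin n → ℕ} → (∀ i → f i ≤ g i) → sum f ≤ sum g
∑-mono-≤ {zero}  f≤g = z≤n
∑-mono-≤ {suc n} f≤g = +-mono-≤ (f≤g Fin.zero) (∑-mono-≤ (λ i → f≤g (Fin.suc i)))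

∑-const : ∀ n c → ∑[ i < n ] c ≡ n * c
∑-const zero    c = refl
∑-const (suc n) c = cong (c +_) (∑-const n c)

β≤∑ : ∀ {β} {f : Fin β → ℕ} → (∀ j → 1 ≤ f j) → β ≤ sum f
β≤∑ {β} {f} f≥1 = subst (_≤ sum f) (trans (∑-const β 1) (*-identityʳ β)) (∑-mono-≤ f≥1)

⟦_⟧ : {A : Set} → Dec A → ℕ
⟦ yes _ ⟧ = 1
⟦ no  _ ⟧ = 0

count-≡-≤1 : ∀ {m} (f : Fin m → ℕ) → Injective _≡_ _≡_ f → ∀ c →
             ∑[ a < m ] ⟦ f a ≟ c ⟧ ≤ 1
count-≡-≤1 {zero}  f inj c = z≤n
count-≡-≤1 {suc m} f inj c with f Fin.zero ≟ c
... | no  _    = count-≡-≤1 (λ a → f (Fin.suc a)) (λ e → Fin-suc-injective (inj e)) c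
... | yes f0≡c = ≤-reflexive (cong suc (trans (sum-cong-≗ others) (sum-replicate-zero m)))
  where
  others : ∀ a → ⟦ f (Fin.suc a) ≟ c ⟧ ≡ 0
  others a with f (Fin.suc a) ≟ c
  ... | no  _ = refl
  ... | yes e with inj (trans e (sym f0≡c))
  ...   | ()

<-suc-split : ∀ x c → ⟦ x <? suc c ⟧ ≤ ⟦ x <? c ⟧ + ⟦ x ≟ c ⟧
<-suc-split x c with x <? suc c | x <? c | x ≟ c
... | no  _         | _      | _      = z≤n
... | yes _         | yes _  | _      = s≤s z≤n
... | yes _         | no _   | yes _  = s≤s z≤n
... | yes (s≤s x≤c) | no x≮c | no x≢c with m≤n⇒m<n∨m≡n x≤c
...   | inj₁ x<c = ⊥-elim (x≮c x<c)
...   | inj₂ x≡c = ⊥-elim (x≢c x≡c)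

count-<-≤ : ∀ {m} (f : Fin m → ℕ) → Injective _≡_ _≡_ f → ∀ c →
            ∑[ a < m ] ⟦ f a <? c ⟧ ≤ c
count-<-≤ {m} f inj zero = ≤-reflexive (trans (sum-cong-≗ nothing-below-0) (sum-replicate-zero m))
  where
  nothing-below-0 : ∀ a → ⟦ f a <? 0 ⟧ ≡ 0
  nothing-below-0 a with f a <? 0
  ... | no _ = refl
count-<-≤ {m} f inj (suc c) = begin
    ∑[ a < m ] ⟦ f a <? suc c ⟧
  ≤⟨ ∑-mono-≤ (λ a → <-suc-split (f a) c) ⟩
    ∑[ a < m ] (⟦ f a <? c ⟧ + ⟦ f a ≟ c ⟧)
  ≡⟨ ∑-distrib-+ (λ a → ⟦ f a <? c ⟧) (λ a → ⟦ f a ≟ c ⟧) ⟩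
    ∑[ a < m ] ⟦ f a <? c ⟧ + ∑[ a < m ] ⟦ f a ≟ c ⟧
  ≤⟨ +-mono-≤ (count-<-≤ f inj c) (count-≡-≤1 f inj c) ⟩
    c + 1
  ≡⟨ +-comm c 1 ⟩
    suc c ∎
  where open ≤-Reasoning

-- Adding two families of residues wraps around exactly once

module WrapAround (p : ℕ) .{{_ : NonZero p}} where

  below-or-wraps : ∀ x y → 1 ≤ y → 1 ≤ ⟦ x <? (x + y) % p ⟧ + (x + y) / p
  below-or-wraps x y y≥1 with x <? (x + y) % p
  ... | yes _ = s≤s z≤n
  ... | no x≮z = n≢0⇒n>0 λ w≡0 → <⇒≱ (begin-strict
      (x + y) % p                  ≤⟨ ≮⇒≥ x≮z ⟩
      x                            <⟨ m<m+n x y≥1 ⟩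
      x + y                        ≡⟨ m≡m%n+[m/n]*n (x + y) p ⟩
      (x + y) % p + (x + y) / p * p ≡⟨ cong (λ w → (x + y) % p + w * p) w≡0 ⟩
      (x + y) % p + 0              ≡⟨ +-identityʳ _ ⟩
      (x + y) % p ∎) ≤-refl
    where open ≤-Reasoning

  -- Three families of residues summing to p each: the carries sum to one,
  -- so z_j ≤ x_j happens for at most one index j.
  one-wrap : ∀ {β} (x y z : Fin β → ℕ) → (∀ j → 1 ≤ y j) →
             (∀ j → (x j + y j) % p ≡ z j) →
             sum x ≡ p → sum y ≡ p → sum z ≡ p →
             β ≤ ∑[ j < β ] ⟦ x j <? z j ⟧ + 1
  one-wrap {β} x y z y≥1 z≡x+y Σx Σy Σz = begin
      β
    ≡⟨ sym (trans (∑-const β 1) (*-identityʳ β)) ⟩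
      ∑[ j < β ] 1
    ≤⟨ ∑-mono-≤ (λ j → subst (λ t → 1 ≤ ⟦ x j <? t ⟧ + w j) (z≡x+y j) (below-or-wraps (x j) (y j) (y≥1 j))) ⟩
      ∑[ j < β ] (⟦ x j <? z j ⟧ + w j)
    ≡⟨ ∑-distrib-+ (λ j → ⟦ x j <? z j ⟧) w ⟩
      ∑[ j < β ] ⟦ x j <? z j ⟧ + sum w
    ≡⟨ cong (∑[ j < β ] ⟦ x j <? z j ⟧ +_) carries-sum ⟩
      ∑[ j < β ] ⟦ x j <? z j ⟧ + 1 ∎
    where
    open ≤-Reasoning
    w : Fin β → ℕ
    w j = (x j + y j) / p
    carries : ∀ j → x j + y j ≡ z j + w j * p
    carries j = trans (m≡m%n+[m/n]*n (x j + y j) p) (cong (_+ w j * p) (z≡x+y j))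
    carries-sum : sum w ≡ 1
    carries-sum = *-cancelʳ-≡ (sum w) 1 p (+-cancelˡ-≡ p _ _ (begin-equality
        p + sum w * p                 ≡⟨ cong₂ _+_ (sym Σz) (*-distribʳ-sum p w) ⟩
        sum z + ∑[ j < β ] (w j * p)  ≡⟨ sym (∑-distrib-+ z (λ j → w j * p)) ⟩
        ∑[ j < β ] (z j + w j * p)    ≡⟨ sum-cong-≗ (λ j → sym (carries j)) ⟩
        ∑[ j < β ] (x j + y j)        ≡⟨ ∑-distrib-+ x y ⟩
        sum x + sum y                 ≡⟨ cong₂ _+_ Σx Σy ⟩
        p + p                         ≡⟨ cong (p +_) (sym (*-identityˡ p)) ⟩
        p + 1 * p ∎))

-- Residues of multiples modulo a prime

module Residues (p : ℕ) .{{_ : NonZero p}} (p-prime : Prime p) where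

  ∤-small : ∀ {d} → 1 ≤ d → d < p → p ∣ d → ⊥
  ∤-small d≥1 d<p p∣d = <⇒≱ d<p (∣⇒≤ {{ >-nonZero d≥1 }} p∣d)

  ∤-product : ∀ {a r} → 1 ≤ a → a < p → 1 ≤ r → r < p → p ∣ a * r → ⊥
  ∤-product {a} {r} a≥1 a<p r≥1 r<p p∣ar with euclidsLemma a r p-prime p∣ar
  ... | inj₁ p∣a = ∤-small a≥1 a<p p∣a
  ... | inj₂ p∣r = ∤-small r≥1 r<p p∣r

  %-equal⇒∣∸ : ∀ u v → u % p ≡ v % p → p ∣ u ∸ v
  %-equal⇒∣∸ u v e = divides (u / p ∸ v / p) (begin
      u ∸ v                                        ≡⟨ cong₂ _∸_ (m≡m%n+[m/n]*n u p) (m≡m%n+[m/n]*n v p) ⟩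
      (u % p + u / p * p) ∸ (v % p + v / p * p)    ≡⟨ cong (λ t → (t + u / p * p) ∸ (v % p + v / p * p)) e ⟩
      (v % p + u / p * p) ∸ (v % p + v / p * p)    ≡⟨ [m+n]∸[m+o]≡n∸o (v % p) _ _ ⟩
      u / p * p ∸ v / p * p                        ≡⟨ sym (*-distribʳ-∸ p (u / p) (v / p)) ⟩
      (u / p ∸ v / p) * p ∎)
    where open ≡-Reasoning

  res : ℕ → ℕ → ℕ
  res r a = (a * r) % p

  res-pos : ∀ {r a} → 1 ≤ r → r < p → 1 ≤ a → a < p → 1 ≤ res r a
  res-pos {r} {a} r≥1 r<p a≥1 a<p =
    n≢0⇒n>0 λ res≡0 → ∤-product a≥1 a<p r≥1 r<p (m%n≡0⇒n∣m (a * r) p res≡0)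

  res-distinct : ∀ {r s t} → 1 ≤ r → r < p → s < t → t < p → res r t ≢ res r s
  res-distinct {r} {s} {t} r≥1 r<p s<t t<p e =
    ∤-product (m<n⇒0<n∸m s<t) (≤-<-trans (m∸n≤m t s) t<p) r≥1 r<p
      (subst (p ∣_) (sym (*-distribʳ-∸ r t s)) (%-equal⇒∣∸ (t * r) (s * r) e))

  res-injective : ∀ {r x y} → 1 ≤ r → r < p → x < p → y < p → res r x ≡ res r y → x ≡ y
  res-injective {r} {x} {y} r≥1 r<p x<p y<p e with <-cmp x y
  ... | tri< x<y _ _ = ⊥-elim (res-distinct r≥1 r<p x<y y<p (sym e))
  ... | tri≈ _ x≡y _ = x≡y
  ... | tri> _ _ y<x = ⊥-elim (res-distinct r≥1 r<p y<x x<p e)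

  res-+ : ∀ r a b → (res r a + res r b) % p ≡ res r (a + b)
  res-+ r a b = trans (sym (%-distribˡ-+ (a * r) (b * r) p)) (cong (_% p) (sym (*-distribʳ-+ r a b)))

-- Fractional parts of fractions a / d with a, d natural and d > 0

module Fractions where
  open import Data.Nat.GCD using (gcd; gcd[m,n]≢0; n/gcd[m,n]≢0; gcd[m,n]∣m; gcd[m,n]∣n)
  open import Data.Nat.Coprimality using (Coprime)
  open import Data.Integer as ℤ using (+_)
  import Data.Integer.Properties as ℤP
  open import Data.Integer.Tactic.RingSolver using (solve-∀)
  open import Data.Rational as ℚ using (ℚ; mkℚ+; floor; toℚᵘ; 0ℚ)
  import Data.Rational.Properties as ℚP
  open import Data.Rational.Unnormalised as ℚᵘ using (mkℚᵘ; *≡*)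
  import Data.Rational.Unnormalised.Properties as ℚᵘP
  open import Data.List.Properties using (map-cong)

  floor-mkℚ+ : ∀ a d .{{_ : NonZero d}} .(c : Coprime a d) → floor (mkℚ+ a d c) ≡ + (a / d)
  floor-mkℚ+ a (suc d) c = ℤP.*-identityˡ (+ (a / suc d))

  -- ⌊a / d⌋ is the natural quotient: reducing the fraction by g = gcd a d
  -- does not change the quotient.
  floor-/ : ∀ a n → floor ((+ a) ℚ./ suc n) ≡ + (a / suc n)
  floor-/ a n = trans (floor-mkℚ+ (a / g) (suc n / g) _) (cong +_ reduced-quotient)
    where
    g : ℕ
    g = gcd a (suc n)
    instance
      g≢0 : NonZero g
      g≢0 = ≢-nonZero (gcd[m,n]≢0 a (suc n) (inj₂ (λ ())))
      d/g≢0 : NonZero (suc n / g)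
      d/g≢0 = ≢-nonZero (n/gcd[m,n]≢0 a (suc n))
      d/g*g≢0 : NonZero ((suc n / g) * g)
      d/g*g≢0 = m*n≢0 (suc n / g) g
    reduced-quotient : (a / g) / (suc n / g) ≡ a / suc n
    reduced-quotient = begin
      (a / g) / (suc n / g)           ≡⟨ sym (m*n/o*n≡m/o (a / g) g (suc n / g)) ⟩
      (a / g * g) / (suc n / g * g)   ≡⟨ /-congˡ (m/n*n≡m (gcd[m,n]∣m a (suc n))) ⟩
      a / (suc n / g * g)             ≡⟨ /-congʳ (m/n*n≡m (gcd[m,n]∣n a (suc n))) ⟩
      a / suc n ∎
      where open ≡-Reasoning

  toℚᵘ-/ : ∀ a n → toℚᵘ ((+ a) ℚ./ suc n) ℚᵘ.≃ mkℚᵘ (+ a) n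
  toℚᵘ-/ a n = ℚP.toℚᵘ-fromℚᵘ (mkℚᵘ (+ a) n)

  frac-/ : ∀ a n → frac ((+ a) ℚ./ suc n) ≡ (+ (a % suc n)) ℚ./ suc n
  frac-/ a n = ℚP.toℚᵘ-injective (ℚᵘP.≃-trans in-ℚᵘ (ℚᵘP.≃-sym (toℚᵘ-/ (a % suc n) n)))
    where
    x : ℚ
    x = (+ a) ℚ./ suc n
    q r : ℕ
    q = a / suc n
    r = a % suc n
    division : + a ≡ + r ℤ.+ + q ℤ.* + suc n
    division = trans (cong +_ (m≡m%n+[m/n]*n a (suc n)))
                     (trans (ℤP.pos-+ r (q * suc n)) (cong (λ t → + r ℤ.+ t) (ℤP.pos-* q (suc n))))
    identity : ∀ R Q D → ((R ℤ.+ Q ℤ.* D) ℤ.* ℤ.1ℤ ℤ.+ (ℤ.- Q) ℤ.* D) ℤ.* D ≡ R ℤ.* D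
    identity = solve-∀
    subtract-quotient : (mkℚᵘ (+ a) n ℚᵘ.- mkℚᵘ (+ q) 0) ℚᵘ.≃ mkℚᵘ (+ r) n
    subtract-quotient = *≡* (trans (cong (λ t → (t ℤ.* + 1 ℤ.+ (ℤ.- + q) ℤ.* + suc n) ℤ.* + suc n) division)
      (trans (identity (+ r) (+ q) (+ suc n)) (cong (λ t → + r ℤ.* + t) (sym (*-identityʳ (suc n))))))
    floor-part : toℚᵘ (floor x ℚ./ 1) ℚᵘ.≃ mkℚᵘ (+ q) 0
    floor-part = subst (λ t → toℚᵘ (t ℚ./ 1) ℚᵘ.≃ mkℚᵘ (+ q) 0) (sym (floor-/ a n)) (toℚᵘ-/ q 0)
    in-ℚᵘ : toℚᵘ (frac x) ℚᵘ.≃ mkℚᵘ (+ r) n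
    in-ℚᵘ = ℚᵘP.≃-trans (ℚP.toℚᵘ-homo-+ x (ℚ.- (floor x ℚ./ 1)))
      (ℚᵘP.≃-trans (ℚᵘP.+-cong (toℚᵘ-/ a n)
         (ℚᵘP.≃-trans (ℚP.toℚᵘ-homo‿- (floor x ℚ./ 1)) (ℚᵘP.-‿cong floor-part)))
       subtract-quotient)

  +-/ : ∀ a b n → (+ a) ℚ./ suc n ℚ.+ (+ b) ℚ./ suc n ≡ (+ (a + b)) ℚ./ suc n
  +-/ a b n = ℚP.toℚᵘ-injective (ℚᵘP.≃-trans (ℚP.toℚᵘ-homo-+ ((+ a) ℚ./ suc n) ((+ b) ℚ./ suc n))
     (ℚᵘP.≃-trans (ℚᵘP.+-cong (toℚᵘ-/ a n) (toℚᵘ-/ b n))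
     (ℚᵘP.≃-trans (*≡* cross-multiplied) (ℚᵘP.≃-sym (toℚᵘ-/ (a + b) n)))))
    where
    identity : ∀ A B D → (A ℤ.* D ℤ.+ B ℤ.* D) ℤ.* D ≡ (A ℤ.+ B) ℤ.* (D ℤ.* D)
    identity = solve-∀
    cross-multiplied : (+ a ℤ.* + suc n ℤ.+ + b ℤ.* + suc n) ℤ.* + suc n ≡ + (a + b) ℤ.* + (suc n * suc n)
    cross-multiplied = trans (identity (+ a) (+ b) (+ suc n))
      (cong₂ ℤ._*_ (sym (ℤP.pos-+ a b)) (sym (ℤP.pos-* (suc n) (suc n))))

  sum-/ : ∀ {A : Set} (x : A → ℕ) n (L : List A) →
          foldr ℚ._+_ 0ℚ (map (λ j → (+ x j) ℚ./ suc n) L) ≡ (+ foldr _+_ 0 (map x L)) ℚ./ suc n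
  sum-/ x n []      = sym (ℚP.0/n≡0 (suc n))
  sum-/ x n (j ∷ L) = trans (cong ((+ x j) ℚ./ suc n ℚ.+_) (sum-/ x n L)) (+-/ (x j) _ n)

  /≡1⇒≡ : ∀ s n → (+ s) ℚ./ suc n ≡ 1ℚ → s ≡ suc n
  /≡1⇒≡ s n e with ℚᵘP.≃-trans (ℚᵘP.≃-sym (toℚᵘ-/ s n)) (ℚP.toℚᵘ-cong e)
  ... | *≡* e′ = ℤP.+-injective (trans (sym (ℤP.*-identityʳ (+ s))) (trans e′ (ℤP.*-identityˡ (+ suc n))))

  H≡1⇒∑res≡p : ∀ n {β} (r : Fin β → ℕ) k → H (suc n) r k ≡ 1ℚ →
               ∑[ j < β ] ((k * r j) % suc n) ≡ suc n
  H≡1⇒∑res≡p n {β} r k H≡1 = trans (sym (sumℕ≡sum res)) (/≡1⇒≡ (sumℕ res) n (begin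
      (+ sumℕ res) ℚ./ suc n
    ≡⟨ sym (sum-/ res n (allFin β)) ⟩
      foldr ℚ._+_ 0ℚ (map (λ j → (+ res j) ℚ./ suc n) (allFin β))
    ≡⟨ cong (foldr ℚ._+_ 0ℚ) (map-cong (λ j → sym (frac-/ (k * r j) n)) (allFin β)) ⟩
      H (suc n) r k
    ≡⟨ H≡1 ⟩
      1ℚ ∎))
    where
    open ≡-Reasoning
    res : Fin β → ℕ
    res j = (k * r j) % suc n

-- Double counting: θ (β - 1) ≤ p

module DoubleCounting (p : ℕ) .{{_ : NonZero p}} (p-prime : Prime p)
                      {β} (r : Fin β → ℕ) (r≥1 : ∀ j → 1 ≤ r j) (r<p : ∀ j → r j < p) where
  open Residues p p-prime
  open WrapAround p

  c : Fin β → ℕ → ℕ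
  c j a = res (r j) a

  ResidueSums : ℕ → Set
  ResidueSums θ = ∀ k → 1 ≤ k → k ≤ θ → ∑[ j < β ] c j k ≡ p

  -- For each a < θ, c_j(a) < c_j(θ) holds for at least β - 1 indices j:
  -- for a = 0 because c_j(θ) > 0, otherwise by one-wrap with b = θ - a.
  many-below : ∀ {θ} → θ < p → ResidueSums θ → (a : Fin θ) →
               β ∸ 1 ≤ ∑[ j < β ] ⟦ c j (toℕ a) <? c j θ ⟧
  many-below {suc m} θ<p S Fin.zero = ≤-trans (m∸n≤m β 1) (β≤∑ zero-below)
    where
    zero-below : ∀ j → 1 ≤ ⟦ c j 0 <? c j (suc m) ⟧
    zero-below j with c j 0 <? c j (suc m)
    ... | yes _ = ≤-refl
    ... | no 0≮cθ = ⊥-elim (0≮cθ (subst (_< c j (suc m)) (sym (m<n⇒m%n≡m (≤-<-trans z≤n θ<p)))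
                                       (res-pos (r≥1 j) (r<p j) (s≤s z≤n) θ<p)))
  many-below {θ@(suc m)} θ<p S (Fin.suc i) =
    m≤n+o⇒m∸n≤o β 1 (subst (β ≤_) (+-comm _ 1) (one-wrap (λ j → c j a) (λ j → c j b) (λ j → c j θ)
      (λ j → res-pos (r≥1 j) (r<p j) b≥1 (≤-<-trans (m∸n≤m θ a) θ<p))
      (λ j → trans (res-+ (r j) a b) (cong (res (r j)) a+b≡θ))
      (S a (s≤s z≤n) (<⇒≤ a<θ)) (S b b≥1 (m∸n≤m θ a)) (S θ (s≤s z≤n) ≤-refl)))
    where
    a b : ℕ
    a = suc (toℕ i)
    b = θ ∸ a
    a<θ : a < θ
    a<θ = s≤s (toℕ<n i)
    b≥1 : 1 ≤ b
    b≥1 = m<n⇒0<n∸m a<θ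
    a+b≡θ : a + b ≡ θ
    a+b≡θ = m+[n∸m]≡n (<⇒≤ a<θ)

  -- By injectivity of a ↦ c_j(a) on [0, p), at most c_j(θ) values a < θ
  -- satisfy c_j(a) < c_j(θ).
  few-below : ∀ {θ} → θ < p → ∀ j → ∑[ a < θ ] ⟦ c j (toℕ a) <? c j θ ⟧ ≤ c j θ
  few-below {θ} θ<p j = count-<-≤ (λ a → c j (toℕ a))
    (λ {a} {a′} e → toℕ-injective (res-injective (r≥1 j) (r<p j) (<-trans (toℕ<n a) θ<p) (<-trans (toℕ<n a′) θ<p) e))
    (c j θ)

  -- Double counting the pairs (a, j) with a < θ and c_j(a) < c_j(θ).
  bound : ∀ θ → θ < p → ResidueSums θ → θ * (β ∸ 1) ≤ p
  bound zero        θ<p S = z≤n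
  bound θ@(suc m) θ<p S = begin
      θ * (β ∸ 1)                                     ≡⟨ sym (∑-const θ (β ∸ 1)) ⟩
      ∑[ a < θ ] (β ∸ 1)                              ≤⟨ ∑-mono-≤ (many-below {θ} θ<p S) ⟩
      ∑[ a < θ ] ∑[ j < β ] ⟦ c j (toℕ a) <? c j θ ⟧  ≡⟨ ∑-comm {θ} {β} (λ a j → ⟦ c j (toℕ a) <? c j θ ⟧) ⟩
      ∑[ j < β ] ∑[ a < θ ] ⟦ c j (toℕ a) <? c j θ ⟧  ≤⟨ ∑-mono-≤ (few-below {θ} θ<p) ⟩
      ∑[ j < β ] c j θ                                ≡⟨ S θ (s≤s z≤n) ≤-refl ⟩
      p ∎
    where open ≤-Reasoning

at-least-two-parts : ∀ {p β} .{{_ : NonZero p}} (f : Fin β → ℕ) →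
                     (∀ j → f j < p) → sum f ≡ p → ∃[ m ] (β ≡ suc (suc m))
at-least-two-parts {p} {zero}        f f<p ∑f≡p = ⊥-elim (≢-nonZero⁻¹ p (sym ∑f≡p))
at-least-two-parts {p} {suc zero}    f f<p ∑f≡p =
  ⊥-elim (<-irrefl (trans (sym (+-identityʳ _)) ∑f≡p) (f<p Fin.zero))
at-least-two-parts {p} {suc (suc m)} f f<p ∑f≡p = m , refl

lemma3p13 : (p : ℕ) → .{{_ : NonZero p}} → Prime p → 3 ≤ p →
    (β : ℕ) (r : Fin β → ℕ) →
    (∀ j → 1 ≤ r j × r j ≤ p ∸ 1) →
    (∀ i j → i Data.Fin.≤ j → r i ≤ r j) →
    p ∣ sumℕ r →
    (θ : ℕ) → 1 ≤ θ → θ ≤ p ∸ 1 →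
    (∀ k → 1 ≤ k → k ≤ θ → H p r k ≡ 1ℚ) →
    β ≤ p × ∃[ m ] (β ≡ suc (suc m) × θ ≤ p / suc m)
lemma3p13 zero () _
lemma3p13 p@(suc n) p-prime _ β r r-bounds _ _ θ θ≥1 θ≤p-1 H≡1 = β≤p , m , β≡2+m , θ≤p/[1+m]
  where
  r≥1 : ∀ j → 1 ≤ r j
  r≥1 j = proj₁ (r-bounds j)
  r<p : ∀ j → r j < p
  r<p j = s≤s (proj₂ (r-bounds j))
  residue-sums : DoubleCounting.ResidueSums p p-prime r r≥1 r<p θ
  residue-sums k k≥1 k≤θ = Fractions.H≡1⇒∑res≡p n r k (H≡1 k k≥1 k≤θ)
  -- k = 1: the r_j themselves sum to p
  ∑r≡p : sum r ≡ p
  ∑r≡p = trans (sum-cong-≗ (λ j → sym (trans (cong (_% p) (*-identityˡ (r j))) (m<n⇒m%n≡m (r<p j)))))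
               (residue-sums 1 ≤-refl θ≥1)
  β≤p : β ≤ p
  β≤p = subst (β ≤_) ∑r≡p (β≤∑ r≥1)
  m : ℕ
  m = proj₁ (at-least-two-parts r r<p ∑r≡p)
  β≡2+m : β ≡ suc (suc m)
  β≡2+m = proj₂ (at-least-two-parts r r<p ∑r≡p)
  θ[1+m]≤p : θ * suc m ≤ p
  θ[1+m]≤p = subst (λ b → θ * (b ∸ 1) ≤ p) β≡2+m
               (DoubleCounting.bound p p-prime r r≥1 r<p θ (s≤s θ≤p-1) residue-sums)
  θ≤p/[1+m] : θ ≤ p / suc m
  θ≤p/[1+m] = subst (_≤ p / suc m) (m*n/n≡m θ (suc m)) (/-monoˡ-≤ (suc m) θ[1+m]≤p)
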